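{- Let $n$ be a positive integer, and call a pair $(a,b)$ of positive integers a maximizing pair for $n$ if $f_n(a,b) \ge f_n(a',b')$ for all pairs $(a',b')$ of positive integers. Then every maximizing pair $(a,b)$ for $n$ satisfies $|a-b|\le 1$.
   Context: For a permutation $\pi = \pi_1\pi_2\cdots\pi_n$ of $\{1,\dots,n\}$, an entry $\pi_i$ is a left-to-right maximum if $\pi_i > \pi_j$ for all $j<i$, and a right-to-left maximum if $\pi_i > \pi_j$ for all $j>i$. The skyscraper number $f_n(a,b)$ is the number of permutations of $\{1,\dots,n\}$ with exactly $a$ left-to-right maxima and exactly $b$ right-to-left maxima. -}

module Defs where

open import Data.Nat using (ℕ; zero; suc; _<_; _<?_)
open import Data.Nat.Properties using (_≟_)
open import Data.Fin using (Fin; toℕ)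
open import Data.Fin.Properties using () renaming (_≟_ to _≟ᶠ_)
open import Data.List using (List; []; _∷_; length; filter; map; concatMap; allFin; reverse)
open import Data.List.Relation.Unary.All using (All)
open import Data.List.Relation.Unary.All.Properties using ()
open import Data.List.Relation.Unary.All as All using (all?)
open import Data.List.Relation.Unary.Unique.Propositional using (Unique)
import Data.List.Relation.Unary.Unique.DecPropositional as UDec
open import Data.Product using (_×_)
open import Relation.Nullary using (Dec; yes; no)
open import Relation.Nullary.Decidable using (_×-dec_)
open import Relation.Binary.PropositionalEquality using (_≡_)

words : (n k : ℕ) → List (List (Fin n))
words n zero = [] ∷ []
words n (suc k) = concatMap (λ x → map (x ∷_) (words n k)) (allFin n)

-- A permutation of {1,…,n} in one-line notation is a word π₁⋯πₙ of length n
-- over Fin n (value i stands for i+1) with pairwise distinct entries.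
perms : (n : ℕ) → List (List (Fin n))
perms n = filter (λ w → UDec.unique? (_≟ᶠ_ {n}) w) (words n n)

ltrMaxAux : List ℕ → List ℕ → ℕ
ltrMaxAux prev [] = 0
ltrMaxAux prev (x ∷ xs) with all? (λ y → y <? x) prev
... | yes _ = suc (ltrMaxAux (x ∷ prev) xs)
... | no _  = ltrMaxAux (x ∷ prev) xs

ltrMax : List ℕ → ℕ
ltrMax = ltrMaxAux []

rtlMax : List ℕ → ℕ
rtlMax w = ltrMax (reverse w)

f : (n a b : ℕ) → ℕ
f n a b = length (filter (λ π → (ltrMax (map toℕ π) ≟ a) ×-dec (rtlMax (map toℕ π) ≟ b)) (perms n))

-- Write the entries as 0,…,n and obtain each permutation of n + 1 entries by inserting the
-- smallest entry 0 into a permutation of the others: in front it is a new left-to-right maximum,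
-- at the end a new right-to-left maximum, and in the n − 1 inner positions it changes neither
-- count.  Hence f_{n+1}(a,b) = f_n(a−1,b) + (n−1) f_n(a,b) + f_n(a,b−1), which is solved by
-- f_{m+1}(i+1,j+1) = C(i+j,i) c(m,i+j) with c the unsigned Stirling numbers of the first kind.
-- On a line a + b = const the binomial factor strictly increases towards the diagonal, and a
-- maximizing pair has f ≥ f_{m+1}(m+1,1) = 1 > 0; so if |a − b| ≥ 2, one step towards the
-- diagonal would increase f.

module Submission where

open import Defs
open import Algebra.Properties.CommutativeSemigroup using (interchange)
open import Data.Bool using (true; false; if_then_else_)
open import Data.Bool.Properties using (∧-zeroʳ)
open import Data.Empty using (⊥-elim)
open import Data.Fin as Fin using (Fin; zero; suc; toℕ)
import Data.Fin.Properties as Finₚ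
open import Data.List
  using (List; []; _∷_; _++_; _ʳ++_; _∷ʳ_; [_]; map; reverse; replicate; length; concat; concatMap; filter;
         allFin; lookup; cartesianProductWith)
open import Data.List.Properties
  using (reverse-++; unfold-reverse; ++-ʳ++; ʳ++-defn; reverse-map; ++-assoc; ++-identityʳ; ∷-injective;
         ∷-injectiveˡ; ∷-injectiveʳ; length-map; map-∘; map-cong; map-cong-local; map-concatMap)
open import Data.List.Membership.Propositional using (_∈_; _∉_; find)
open import Data.List.Membership.Propositional.Properties
  using (∈-map⁺; ∈-map⁻; ∈-concatMap⁺; ∈-concatMap⁻; ∈-cartesianProductWith⁺; ∈-cartesianProductWith⁻;
         ∈-allFin; ∈-∃++; ∈-filter⁺; ∈-filter⁻; ∈-lookup)
open import Data.List.Membership.Propositional.Properties.WithK using (unique∧set⇒bag)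
open import Data.List.Relation.Binary.BagAndSetEquality using (∼bag⇒↭)
open import Data.List.Relation.Binary.Permutation.Propositional using (_↭_; ↭-sym; ↭⇒↭ₛ)
open import Data.List.Relation.Binary.Permutation.Propositional.Properties using (↭-length; shift; map⁺)
import Data.List.Relation.Binary.Permutation.Setoid.Properties as Permₛ
open import Data.List.Relation.Unary.All as All using (All; []; _∷_; all?)
import Data.List.Relation.Unary.All.Properties as AllP
open import Data.List.Relation.Unary.AllPairs as AllPairs using ([]; _∷_)
import Data.List.Relation.Unary.AllPairs.Properties as AllPairsP
open import Data.List.Relation.Unary.Any as Any using (here; there)
import Data.List.Relation.Unary.Any.Properties as AnyP
open import Data.List.Relation.Unary.Unique.Propositional using (Unique)
import Data.List.Relation.Unary.Unique.Propositional.Properties as Uniqueₚ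
import Data.List.Relation.Unary.Unique.DecPropositional as UniqueDec
open import Data.Nat
  using (ℕ; zero; suc; _+_; _*_; _∸_; _≤_; _<_; _≥_; _<?_; z≤n; s≤s; s<s⁻¹; NonZero; >-nonZero)
open import Data.Nat.ListAction using (sum)
open import Data.Nat.ListAction.Properties using (sum-++; sum-↭)
open import Data.Nat.Properties
  using (_≟_; +-identityʳ; +-assoc; +-comm; +-suc; *-identityʳ; *-zeroʳ; *-distribˡ-+; suc-injective;
         ≤-trans; m≤m+n; ≤-<-trans; <-irrefl; ≰⇒>; ≮⇒≥; <⇒≱; *-monoˡ-<; *-monoʳ-≤; m*n≢0⇒n≢0;
         m≤n+o⇒m∸n≤o; +-commutativeSemigroup; module ≤-Reasoning)
open import Data.Nat.Tactic.RingSolver using (solve-∀)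
open import Data.Product using (_×_; _,_; ∃₂; map₁; map₂; proj₁)
open import Function using (_∘_; _⇔_; mk⇔; Equivalence)
open import Level using (0ℓ)
open import Relation.Binary.PropositionalEquality
  using (_≡_; refl; sym; trans; cong; cong₂; subst; subst₂; setoid; module ≡-Reasoning)
open import Relation.Nullary using (yes; no; does; contradiction)
open import Relation.Nullary.Decidable using (_×-dec_)
open import Relation.Unary using (Pred; Decidable)

open Equivalence using (to; from)

module _ {A : Set} where

  All-reverse : ∀ {P : A → Set} {xs} → All P xs → All P (reverse xs)
  All-reverse ps = All.tabulate (λ x∈ → All.lookup ps (AnyP.reverse⁻ x∈))

  reverse-++-∷ : ∀ (xs : List A) y vs → reverse (xs ++ y ∷ vs) ≡ (reverse vs ∷ʳ y) ++ reverse xs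
  reverse-++-∷ xs y vs = begin
    reverse (xs ++ y ∷ vs)          ≡⟨ ++-ʳ++ xs ⟩
    vs ʳ++ (y ∷ reverse xs)         ≡⟨ ʳ++-defn vs ⟩
    reverse vs ++ y ∷ reverse xs    ≡⟨ ++-assoc (reverse vs) [ y ] (reverse xs) ⟨
    (reverse vs ∷ʳ y) ++ reverse xs ∎
    where open ≡-Reasoning

  Unique-resp-↭ : {xs ys : List A} → xs ↭ ys → Unique xs → Unique ys
  Unique-resp-↭ p = Permₛ.Unique-resp-↭ (setoid A) (↭⇒↭ₛ p)

  Unique-insert⁻ : ∀ (us : List A) {x vs} → Unique (us ++ x ∷ vs) → x ∉ us ++ vs × Unique (us ++ vs)
  Unique-insert⁻ us {x} {vs} u with x≢ ∷ u′ ← Unique-resp-↭ (shift x us vs) u = AllP.All¬⇒¬Any x≢ , u′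

  Unique-insert⁺ : ∀ (us : List A) {x vs} → x ∉ us ++ vs → Unique (us ++ vs) → Unique (us ++ x ∷ vs)
  Unique-insert⁺ us {x} {vs} x∉ u = Unique-resp-↭ (↭-sym (shift x us vs)) (AllP.¬Any⇒All¬ _ x∉ ∷ u)

  Unique-lookup-injective : ∀ {xs : List A} → Unique xs → ∀ {i j} → lookup xs i ≡ lookup xs j → i ≡ j
  Unique-lookup-injective (x≢ ∷ u) {zero}  {zero}  eq = refl
  Unique-lookup-injective (x≢ ∷ u) {zero}  {suc j} eq = ⊥-elim (All.lookup x≢ (∈-lookup j) eq)
  Unique-lookup-injective (x≢ ∷ u) {suc i} {zero}  eq = ⊥-elim (All.lookup x≢ (∈-lookup i) (sym eq))
  Unique-lookup-injective (x≢ ∷ u) {suc i} {suc j} eq = cong suc (Unique-lookup-injective u eq)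

  Unique-concatMap : ∀ {B : Set} (g : A → List B) {xs} → Unique xs → (∀ x → Unique (g x)) →
                     (∀ {x y w} → w ∈ g x → w ∈ g y → x ≡ y) → Unique (concatMap g xs)
  Unique-concatMap g u g-unique g-disjoint =
    Uniqueₚ.concat⁺ (AllP.map⁺ (All.universal g-unique _))
                    (AllPairsP.map⁺ (AllPairs.map (λ x≢y {_} (w∈ , w∈′) → x≢y (g-disjoint w∈ w∈′)) u))

  length-filter≡sum : ∀ {P : Pred A 0ℓ} (P? : Decidable P) xs →
                      length (filter P? xs) ≡ sum (map (λ x → if does (P? x) then 1 else 0) xs)
  length-filter≡sum P? [] = refl
  length-filter≡sum P? (x ∷ xs) with does (P? x)
  ... | true  = cong suc (length-filter≡sum P? xs)
  ... | false = length-filter≡sum P? xs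

  sum-map-+ : ∀ (g h : A → ℕ) xs → sum (map (λ x → g x + h x) xs) ≡ sum (map g xs) + sum (map h xs)
  sum-map-+ g h []       = refl
  sum-map-+ g h (x ∷ xs) = begin
    g x + h x + sum (map (λ x → g x + h x) xs)          ≡⟨ cong (g x + h x +_) (sum-map-+ g h xs) ⟩
    g x + h x + (sum (map g xs) + sum (map h xs))       ≡⟨ interchange +-commutativeSemigroup (g x) (h x) (sum (map g xs)) (sum (map h xs)) ⟩
    g x + sum (map g xs) + (h x + sum (map h xs))       ∎
    where open ≡-Reasoning

  sum-map-* : ∀ m (g : A → ℕ) xs → sum (map (λ x → m * g x) xs) ≡ m * sum (map g xs)
  sum-map-* m g []       = sym (*-zeroʳ m)
  sum-map-* m g (x ∷ xs) = trans (cong (m * g x +_) (sum-map-* m g xs)) (sym (*-distribˡ-+ m (g x) (sum (map g xs))))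

  sum-map-const-0 : ∀ (xs : List A) → sum (map (λ _ → 0) xs) ≡ 0
  sum-map-const-0 []       = refl
  sum-map-const-0 (_ ∷ xs) = sum-map-const-0 xs

  sum-map-replicate-∷ʳ : ∀ (φ : A → ℕ) k v w → sum (map φ (replicate k v ++ [ w ])) ≡ k * φ v + φ w
  sum-map-replicate-∷ʳ φ zero    v w = +-identityʳ (φ w)
  sum-map-replicate-∷ʳ φ (suc k) v w = trans (cong (φ v +_) (sum-map-replicate-∷ʳ φ k v w)) (sym (+-assoc (φ v) (k * φ v) (φ w)))

sum-concat : ∀ (xss : List (List ℕ)) → sum (concat xss) ≡ sum (map sum xss)
sum-concat []         = refl
sum-concat (xs ∷ xss) = trans (sum-++ xs (concat xss)) (cong (sum xs +_) (sum-concat xss))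

sum-map-concatMap : ∀ {A B : Set} (φ : B → ℕ) (g : A → List B) xs →
                    sum (map φ (concatMap g xs)) ≡ sum (map (sum ∘ map φ ∘ g) xs)
sum-map-concatMap φ g xs = begin
  sum (map φ (concatMap g xs))       ≡⟨ cong sum (map-concatMap φ g xs) ⟩
  sum (concatMap (map φ ∘ g) xs)     ≡⟨ sum-concat (map (map φ ∘ g) xs) ⟩
  sum (map sum (map (map φ ∘ g) xs)) ≡⟨ cong sum (map-∘ xs) ⟨
  sum (map (sum ∘ map φ ∘ g) xs)     ∎
  where open ≡-Reasoning

concatMap-map≡cartesianProductWith : ∀ {A B C : Set} (g : A → B → C) xs ys →
  concatMap (λ x → map (g x) ys) xs ≡ cartesianProductWith g xs ys
concatMap-map≡cartesianProductWith g []       ys = refl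
concatMap-map≡cartesianProductWith g (x ∷ xs) ys = cong (map (g x) ys ++_) (concatMap-map≡cartesianProductWith g xs ys)

insertions : {A : Set} → A → List A → List (List A)
insertions x [] = [ [ x ] ]
insertions x (y ∷ ys) = (x ∷ y ∷ ys) ∷ map (y ∷_) (insertions x ys)

module _ {A : Set} where

  map-insertions : ∀ {B : Set} (g : A → B) x ys → map (map g) (insertions x ys) ≡ insertions (g x) (map g ys)
  map-insertions g x [] = refl
  map-insertions g x (y ∷ ys) = cong ((g x ∷ g y ∷ map g ys) ∷_) (begin
    map (map g) (map (y ∷_) (insertions x ys))      ≡⟨ map-∘ (insertions x ys) ⟨
    map (map g ∘ (y ∷_)) (insertions x ys)          ≡⟨ map-∘ (insertions x ys) ⟩
    map (g y ∷_) (map (map g) (insertions x ys))    ≡⟨ cong (map (g y ∷_)) (map-insertions g x ys) ⟩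
    map (g y ∷_) (insertions (g x) (map g ys))      ∎)
    where open ≡-Reasoning

  ∈-insertions⁺ : ∀ (x : A) us vs → us ++ x ∷ vs ∈ insertions x (us ++ vs)
  ∈-insertions⁺ x [] []       = here refl
  ∈-insertions⁺ x [] (v ∷ vs) = here refl
  ∈-insertions⁺ x (u ∷ us) vs = there (∈-map⁺ (u ∷_) (∈-insertions⁺ x us vs))

  ∈-insertions⁻ : ∀ (x : A) ys {w} → w ∈ insertions x ys → ∃₂ λ us vs → ys ≡ us ++ vs × w ≡ us ++ x ∷ vs
  ∈-insertions⁻ x []       (here refl) = [] , [] , refl , refl
  ∈-insertions⁻ x (y ∷ ys) (here refl) = [] , y ∷ ys , refl , refl
  ∈-insertions⁻ x (y ∷ ys) (there w∈)
    with w′ , w′∈ , refl ← ∈-map⁻ (y ∷_) w∈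
    with us , vs , refl , refl ← ∈-insertions⁻ x ys w′∈ = y ∷ us , vs , refl , refl

  Unique-insertions : ∀ (x : A) ys → x ∉ ys → Unique (insertions x ys)
  Unique-insertions x []       _  = [] ∷ []
  Unique-insertions x (y ∷ ys) x∉ =
    AllP.map⁺ (All.universal (λ _ eq → x∉ (here (∷-injectiveˡ eq))) _)
    ∷ Uniqueₚ.map⁺ ∷-injectiveʳ (Unique-insertions x ys (x∉ ∘ there))

-- Maxima of a word of positive entries when 0 is inserted

-- ltrMaxAux consults its accumulator only through the positive values exceeding all of it.
SameBounds : List ℕ → List ℕ → Set
SameBounds p q = ∀ {x} → 0 < x → All (_< x) p ⇔ All (_< x) q

SameBounds-∷ : ∀ {p q} y → SameBounds p q → SameBounds (y ∷ p) (y ∷ q)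
SameBounds-∷ y p≈q x>0 = mk⇔ (λ { (a ∷ as) → a ∷ to (p≈q x>0) as }) (λ { (a ∷ as) → a ∷ from (p≈q x>0) as })

ltrMaxAux-cong : ∀ {p q} ys → SameBounds p q → All (0 <_) ys → ltrMaxAux p ys ≡ ltrMaxAux q ys
ltrMaxAux-cong [] p≈q _ = refl
ltrMaxAux-cong {p} {q} (y ∷ ys) p≈q (y>0 ∷ ys>0)
  with all? (_<? y) p | all? (_<? y) q
... | yes _   | yes _   = cong suc (ltrMaxAux-cong ys (SameBounds-∷ y p≈q) ys>0)
... | yes p<y | no q≮y  = ⊥-elim (q≮y (to (p≈q y>0) p<y))
... | no p≮y  | yes q<y = ⊥-elim (p≮y (from (p≈q y>0) q<y))
... | no _    | no _    = ltrMaxAux-cong ys (SameBounds-∷ y p≈q) ys>0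

ltrMaxAux-0∷ : ∀ p ys → All (0 <_) ys → ltrMaxAux (0 ∷ p) ys ≡ ltrMaxAux p ys
ltrMaxAux-0∷ p ys = ltrMaxAux-cong ys (λ x>0 → mk⇔ All.tail (x>0 ∷_))

ltrMax-0∷ : ∀ ys → All (0 <_) ys → ltrMax (0 ∷ ys) ≡ suc (ltrMax ys)
ltrMax-0∷ ys ys>0 = cong suc (ltrMaxAux-0∷ [] ys ys>0)

ltrMaxAux-skip-0 : ∀ x p ys → All (0 <_) ys → ltrMaxAux (x ∷ p) (0 ∷ ys) ≡ ltrMaxAux (x ∷ p) ys
ltrMaxAux-skip-0 x p ys ys>0 with all? (_<? 0) (x ∷ p)
... | yes (() ∷ _)
... | no _ = ltrMaxAux-0∷ (x ∷ p) ys ys>0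

ltrMaxAux-insert-0 : ∀ p xs x ys → All (0 <_) ys →
                     ltrMaxAux p ((xs ∷ʳ x) ++ 0 ∷ ys) ≡ ltrMaxAux p ((xs ∷ʳ x) ++ ys)
ltrMaxAux-insert-0 p [] x ys ys>0 with all? (_<? x) p
... | yes _ = cong suc (ltrMaxAux-skip-0 x p ys ys>0)
... | no _  = ltrMaxAux-skip-0 x p ys ys>0
ltrMaxAux-insert-0 p (z ∷ xs) x ys ys>0 with all? (_<? z) p
... | yes _ = cong suc (ltrMaxAux-insert-0 (z ∷ p) xs x ys ys>0)
... | no _  = ltrMaxAux-insert-0 (z ∷ p) xs x ys ys>0

ltrMaxAux-map-suc : ∀ p ys → ltrMaxAux (map suc p) (map suc ys) ≡ ltrMaxAux p ys
ltrMaxAux-map-suc p [] = refl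
ltrMaxAux-map-suc p (y ∷ ys) with all? (_<? suc y) (map suc p) | all? (_<? y) p
... | yes _   | yes _   = cong suc (ltrMaxAux-map-suc (y ∷ p) ys)
... | yes p<y | no p≮y  = ⊥-elim (p≮y (All.map s<s⁻¹ (AllP.map⁻ p<y)))
... | no p≮y  | yes p<y = ⊥-elim (p≮y (AllP.map⁺ (All.map s≤s p<y)))
... | no _    | no _    = ltrMaxAux-map-suc (y ∷ p) ys

ltrMax-map-suc : ∀ ys → ltrMax (map suc ys) ≡ ltrMax ys
ltrMax-map-suc = ltrMaxAux-map-suc []

rtlMax-map-suc : ∀ ys → rtlMax (map suc ys) ≡ rtlMax ys
rtlMax-map-suc ys = trans (cong ltrMax (sym (reverse-map suc ys))) (ltrMax-map-suc (reverse ys))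

rtlMax-∷ʳ-0 : ∀ xs → All (0 <_) xs → rtlMax (xs ∷ʳ 0) ≡ suc (rtlMax xs)
rtlMax-∷ʳ-0 xs xs>0 = trans (cong ltrMax (reverse-++ xs [ 0 ])) (ltrMax-0∷ (reverse xs) (All-reverse xs>0))

rtlMax-insert-0 : ∀ xs y vs → All (0 <_) xs → rtlMax (xs ++ 0 ∷ y ∷ vs) ≡ rtlMax (xs ++ y ∷ vs)
rtlMax-insert-0 xs y vs xs>0 = begin
  ltrMax (reverse (xs ++ 0 ∷ y ∷ vs))              ≡⟨ cong ltrMax (reverse-++-∷ xs 0 (y ∷ vs)) ⟩
  ltrMax ((reverse (y ∷ vs) ∷ʳ 0) ++ reverse xs)   ≡⟨ cong ltrMax (++-assoc (reverse (y ∷ vs)) [ 0 ] (reverse xs)) ⟩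
  ltrMax (reverse (y ∷ vs) ++ 0 ∷ reverse xs)      ≡⟨ cong (λ ws → ltrMax (ws ++ 0 ∷ reverse xs)) (unfold-reverse y vs) ⟩
  ltrMax ((reverse vs ∷ʳ y) ++ 0 ∷ reverse xs)     ≡⟨ ltrMaxAux-insert-0 [] (reverse vs) y (reverse xs) (All-reverse xs>0) ⟩
  ltrMax ((reverse vs ∷ʳ y) ++ reverse xs)         ≡⟨ cong ltrMax (reverse-++-∷ xs y vs) ⟨
  ltrMax (reverse (xs ++ y ∷ vs))                  ∎
  where open ≡-Reasoning

All-map-suc : ∀ ys → All (0 <_) (map suc ys)
All-map-suc ys = AllP.map⁺ (All.universal (λ _ → s≤s z≤n) ys)

maxima : List ℕ → ℕ × ℕ
maxima w = ltrMax w , rtlMax w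

maxima-map-suc : ∀ ys → maxima (map suc ys) ≡ maxima ys
maxima-map-suc ys = cong₂ _,_ (ltrMax-map-suc ys) (rtlMax-map-suc ys)

maxima-0∷-map-suc : ∀ y ys → maxima (0 ∷ map suc (y ∷ ys)) ≡ map₁ suc (maxima (y ∷ ys))
maxima-0∷-map-suc y ys = cong₂ _,_
  (trans (ltrMax-0∷ (map suc (y ∷ ys)) (All-map-suc (y ∷ ys))) (cong suc (ltrMax-map-suc (y ∷ ys))))
  (trans (rtlMax-insert-0 [] (suc y) (map suc ys) []) (rtlMax-map-suc (y ∷ ys)))

maxima-∷ʳ-0 : ∀ xs x → All (0 <_) (xs ∷ʳ x) → maxima ((xs ∷ʳ x) ∷ʳ 0) ≡ map₂ suc (maxima (xs ∷ʳ x))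
maxima-∷ʳ-0 xs x pre>0 = cong₂ _,_
  (trans (ltrMaxAux-insert-0 [] xs x [] []) (cong ltrMax (++-identityʳ (xs ∷ʳ x))))
  (rtlMax-∷ʳ-0 (xs ∷ʳ x) pre>0)

maxima-insert-0 : ∀ xs x y ys → All (0 <_) (xs ∷ʳ x) → All (0 <_) (y ∷ ys) →
                  maxima ((xs ∷ʳ x) ++ 0 ∷ y ∷ ys) ≡ maxima ((xs ∷ʳ x) ++ y ∷ ys)
maxima-insert-0 xs x y ys pre>0 ys>0 = cong₂ _,_
  (ltrMaxAux-insert-0 [] xs x (y ∷ ys) ys>0)
  (rtlMax-insert-0 (xs ∷ʳ x) y ys pre>0)

maxima-insertions-after : ∀ xs x ys → All (0 <_) (xs ∷ʳ x) → All (0 <_) ys →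
  map (maxima ∘ ((xs ∷ʳ x) ++_)) (insertions 0 ys) ≡
  replicate (length ys) (maxima ((xs ∷ʳ x) ++ ys)) ++ [ map₂ suc (maxima ((xs ∷ʳ x) ++ ys)) ]
maxima-insertions-after xs x [] pre>0 [] =
  cong [_] (trans (maxima-∷ʳ-0 xs x pre>0) (cong (map₂ suc ∘ maxima) (sym (++-identityʳ (xs ∷ʳ x)))))
maxima-insertions-after xs x (y ∷ ys) pre>0 ys>0@(y>0 ∷ ys'>0) = cong₂ _∷_
  (maxima-insert-0 xs x y ys pre>0 ys>0)
  (begin
    map (maxima ∘ (pre ++_)) (map (y ∷_) (insertions 0 ys))   ≡⟨ map-∘ (insertions 0 ys) ⟨
    map (maxima ∘ (pre ++_) ∘ (y ∷_)) (insertions 0 ys)       ≡⟨ map-cong (λ ws → cong maxima (++-assoc pre [ y ] ws)) (insertions 0 ys) ⟨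
    map (maxima ∘ ((pre ∷ʳ y) ++_)) (insertions 0 ys)         ≡⟨ maxima-insertions-after pre y ys (AllP.++⁺ pre>0 (y>0 ∷ [])) ys'>0 ⟩
    replicate (length ys) (maxima ((pre ∷ʳ y) ++ ys)) ++ [ map₂ suc (maxima ((pre ∷ʳ y) ++ ys)) ]
      ≡⟨ cong (λ ws → replicate (length ys) (maxima ws) ++ [ map₂ suc (maxima ws) ]) (++-assoc pre [ y ] ys) ⟩
    replicate (length ys) (maxima (pre ++ y ∷ ys)) ++ [ map₂ suc (maxima (pre ++ y ∷ ys)) ] ∎)
  where
  open ≡-Reasoning
  pre = xs ∷ʳ x

maxima-insertions-0 : ∀ y ys →
  map maxima (insertions 0 (map suc (y ∷ ys))) ≡
  map₁ suc (maxima (y ∷ ys)) ∷ replicate (length ys) (maxima (y ∷ ys)) ++ [ map₂ suc (maxima (y ∷ ys)) ]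
maxima-insertions-0 y ys = cong₂ _∷_ (maxima-0∷-map-suc y ys) (begin
  map maxima (map (suc y ∷_) (insertions 0 (map suc ys)))       ≡⟨ map-∘ (insertions 0 (map suc ys)) ⟨
  map (maxima ∘ ([] ∷ʳ suc y ++_)) (insertions 0 (map suc ys))   ≡⟨ maxima-insertions-after [] (suc y) (map suc ys) (s≤s z≤n ∷ []) (All-map-suc ys) ⟩
  replicate (length (map suc ys)) (maxima w) ++ [ map₂ suc (maxima w) ]
    ≡⟨ cong₂ (λ n s → replicate n s ++ [ map₂ suc s ]) (length-map suc ys) (maxima-map-suc (y ∷ ys)) ⟩
  replicate (length ys) (maxima (y ∷ ys)) ++ [ map₂ suc (maxima (y ∷ ys)) ] ∎)
  where
  open ≡-Reasoning
  w = map suc (y ∷ ys)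

-- Two enumerations of the permutations

Unique-length≤ : ∀ {n} {w : List (Fin n)} → Unique w → length w ≤ n
Unique-length≤ {n} {w} u = ≮⇒≥ λ n<|w| →
  let i , j , i<j , wᵢ≡wⱼ = Finₚ.pigeonhole n<|w| (lookup w)
  in Finₚ.<-irrefl (Unique-lookup-injective u wᵢ≡wⱼ) i<j

unsuc : ∀ {n} → List (Fin (suc n)) → List (Fin n)
unsuc []          = []
unsuc (zero ∷ w)  = unsuc w
unsuc (suc i ∷ w) = i ∷ unsuc w

unsuc-map-suc : ∀ {n} (p : List (Fin n)) → unsuc (map suc p) ≡ p
unsuc-map-suc []      = refl
unsuc-map-suc (i ∷ p) = cong (i ∷_) (unsuc-map-suc p)

map-suc-unsuc : ∀ {n} (w : List (Fin (suc n))) → zero ∉ w → map suc (unsuc w) ≡ w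
map-suc-unsuc []          _    = refl
map-suc-unsuc (zero ∷ w)  zero∉ = contradiction (here refl) zero∉
map-suc-unsuc (suc i ∷ w) zero∉ = cong (suc i ∷_) (map-suc-unsuc w (zero∉ ∘ there))

unsuc-insert-zero : ∀ {n} (us vs : List (Fin (suc n))) → unsuc (us ++ zero ∷ vs) ≡ unsuc (us ++ vs)
unsuc-insert-zero []          vs = refl
unsuc-insert-zero (zero ∷ us)  vs = unsuc-insert-zero us vs
unsuc-insert-zero (suc i ∷ us) vs = cong (i ∷_) (unsuc-insert-zero us vs)

unsuc-insertions : ∀ {n} (p : List (Fin n)) {w} → w ∈ insertions zero (map suc p) → unsuc w ≡ p
unsuc-insertions p w∈ with us , vs , eq , refl ← ∈-insertions⁻ zero (map suc p) w∈ = begin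
  unsuc (us ++ zero ∷ vs) ≡⟨ unsuc-insert-zero us vs ⟩
  unsuc (us ++ vs)        ≡⟨ cong unsuc eq ⟨
  unsuc (map suc p)       ≡⟨ unsuc-map-suc p ⟩
  p                       ∎
  where open ≡-Reasoning

zero∉map-suc : ∀ {n} (p : List (Fin n)) → Fin.zero ∉ map Fin.suc p
zero∉map-suc p zero∈ with ∈-map⁻ suc zero∈
... | _ , _ , ()

length-unsuc : ∀ {n} (w : List (Fin (suc n))) → zero ∉ w → length (unsuc w) ≡ length w
length-unsuc w zero∉ = trans (sym (length-map suc (unsuc w))) (cong length (map-suc-unsuc w zero∉))

Unique-unsuc : ∀ {n} (w : List (Fin (suc n))) → zero ∉ w → Unique w → Unique (unsuc w)
Unique-unsuc w zero∉ u = Uniqueₚ.map⁻ (subst Unique (sym (map-suc-unsuc w zero∉)) u)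

zero∈-Unique : ∀ {n} (w : List (Fin (suc n))) → length w ≡ suc n → Unique w → zero ∈ w
zero∈-Unique {n} w |w| u with Any.any? (zero Finₚ.≟_) w
... | yes zero∈ = zero∈
... | no zero∉  = contradiction
  (subst (_≤ n) (trans (length-unsuc w zero∉) |w|) (Unique-length≤ (Unique-unsuc w zero∉ u)))
  (<-irrefl refl)

words-suc : ∀ n k → words n (suc k) ≡ cartesianProductWith _∷_ (allFin n) (words n k)
words-suc n k = concatMap-map≡cartesianProductWith _∷_ (allFin n) (words n k)

Unique-words : ∀ n k → Unique (words n k)
Unique-words n zero    = [] ∷ []
Unique-words n (suc k) rewrite words-suc n k =
  Uniqueₚ.cartesianProductWith⁺ _∷_ ∷-injective (Uniqueₚ.allFin⁺ n) (Unique-words n k)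

∈-words⁺ : ∀ {n} (w : List (Fin n)) → w ∈ words n (length w)
∈-words⁺ []      = here refl
∈-words⁺ {n} (i ∷ w) rewrite words-suc n (length w) = ∈-cartesianProductWith⁺ _∷_ (∈-allFin i) (∈-words⁺ w)

∈-words⁻ : ∀ {n} k {w} → w ∈ words n k → length w ≡ k
∈-words⁻ zero    (here refl) = refl
∈-words⁻ {n} (suc k) w∈ rewrite words-suc n k
  with _ , _ , _ , w′∈ , refl ← ∈-cartesianProductWith⁻ _∷_ (allFin n) (words n k) w∈ = cong suc (∈-words⁻ k w′∈)

Unique-perms : ∀ n → Unique (perms n)
Unique-perms n = Uniqueₚ.filter⁺ _ (Unique-words n n)

∈-perms⁺ : ∀ n {w} → length w ≡ n → Unique w → w ∈ perms n
∈-perms⁺ n {w} |w| u = ∈-filter⁺ (UniqueDec.unique? Finₚ._≟_) (subst (λ k → w ∈ words n k) |w| (∈-words⁺ w)) u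

∈-perms⁻ : ∀ n {w} → w ∈ perms n → length w ≡ n × Unique w
∈-perms⁻ n w∈ with w∈words , u ← ∈-filter⁻ (UniqueDec.unique? Finₚ._≟_) w∈ = ∈-words⁻ n w∈words , u

insertionPerms : ∀ n → List (List (Fin n))
insertionPerms zero    = [ [] ]
insertionPerms (suc n) = concatMap (insertions zero ∘ map suc) (insertionPerms n)

Unique-insertionPerms : ∀ n → Unique (insertionPerms n)
Unique-insertionPerms zero    = [] ∷ []
Unique-insertionPerms (suc n) = Unique-concatMap (insertions zero ∘ map suc) (Unique-insertionPerms n)
  (λ p → Unique-insertions zero (map suc p) (zero∉map-suc p))
  (λ w∈ w∈′ → trans (sym (unsuc-insertions _ w∈)) (unsuc-insertions _ w∈′))

∈-insertionPerms⁻ : ∀ n {w} → w ∈ insertionPerms n → length w ≡ n × Unique w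
∈-insertionPerms⁻ zero    (here refl) = refl , []
∈-insertionPerms⁻ (suc n) w∈
  with p , p∈ , w∈ins ← find (∈-concatMap⁻ (insertions zero ∘ map suc) {xs = insertionPerms n} w∈)
  with |p| , p-unique ← ∈-insertionPerms⁻ n p∈
  with us , vs , eq , refl ← ∈-insertions⁻ zero (map suc p) w∈ins =
    trans (↭-length (shift zero us vs)) (cong suc (trans (cong length (sym eq)) (trans (length-map suc p) |p|))) ,
    Unique-insert⁺ us (subst (zero ∉_) eq (zero∉map-suc p)) (subst Unique eq (Uniqueₚ.map⁺ Finₚ.suc-injective p-unique))

∈-insertionPerms⁺ : ∀ n {w} → length w ≡ n → Unique w → w ∈ insertionPerms n
∈-insertionPerms⁺ zero    {[]} _ _ = here refl
∈-insertionPerms⁺ (suc n) {w} |w| u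
  with us , vs , refl ← ∈-∃++ (zero∈-Unique w |w| u)
  with zero∉ , u′ ← Unique-insert⁻ us u =
    ∈-concatMap⁺ (insertions zero ∘ map suc) (Any.map (λ { refl → w∈ins }) p∈)
  where
  p = unsuc (us ++ vs)
  p∈ : p ∈ insertionPerms n
  p∈ = ∈-insertionPerms⁺ n
    (trans (length-unsuc (us ++ vs) zero∉) (suc-injective (trans (sym (↭-length (shift zero us vs))) |w|)))
    (Unique-unsuc (us ++ vs) zero∉ u′)
  w∈ins : us ++ zero ∷ vs ∈ insertions zero (map suc p)
  w∈ins rewrite map-suc-unsuc (us ++ vs) zero∉ = ∈-insertions⁺ zero us vs

perms↭insertionPerms : ∀ n → perms n ↭ insertionPerms n
perms↭insertionPerms n = ∼bag⇒↭ (unique∧set⇒bag (Unique-perms n) (Unique-insertionPerms n) (λ {w} → mk⇔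
  (λ w∈ → let |w| , u = ∈-perms⁻ n w∈ in ∈-insertionPerms⁺ n |w| u)
  (λ w∈ → let |w| , u = ∈-insertionPerms⁻ n w∈ in ∈-perms⁺ n |w| u)))

-- The insertion recurrence for f

permMaxima : ∀ {n} → List (Fin n) → ℕ × ℕ
permMaxima π = maxima (map toℕ π)

sum-map-insertions : ∀ {m} (φ : ℕ × ℕ → ℕ) (p : List (Fin (suc m))) → length p ≡ suc m →
  sum (map (φ ∘ permMaxima) (insertions Fin.zero (map Fin.suc p))) ≡
  φ (map₁ suc (permMaxima p)) + m * φ (permMaxima p) + φ (map₂ suc (permMaxima p))
sum-map-insertions {m} φ p@(i ∷ is) |p| = begin
  sum (map (φ ∘ maxima ∘ map toℕ) ws)
    ≡⟨ cong sum (trans (map-∘ ws) (map-∘ (map (map toℕ) ws))) ⟩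
  sum (map φ (map maxima (map (map toℕ) ws)))
    ≡⟨ cong (sum ∘ map φ ∘ map maxima) (map-insertions toℕ Fin.zero (map Fin.suc p)) ⟩
  sum (map φ (map maxima (insertions 0 (map toℕ (map Fin.suc p)))))
    ≡⟨ cong (sum ∘ map φ ∘ map maxima ∘ insertions 0) (trans (sym (map-∘ p)) (map-∘ p)) ⟩
  sum (map φ (map maxima (insertions 0 (map suc (toℕ i ∷ map toℕ is)))))
    ≡⟨ cong (sum ∘ map φ) (maxima-insertions-0 (toℕ i) (map toℕ is)) ⟩
  φ (map₁ suc s) + sum (map φ (replicate (length (map toℕ is)) s ++ [ map₂ suc s ]))
    ≡⟨ cong (φ (map₁ suc s) +_) (sum-map-replicate-∷ʳ φ (length (map toℕ is)) s (map₂ suc s)) ⟩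
  φ (map₁ suc s) + (length (map toℕ is) * φ s + φ (map₂ suc s))
    ≡⟨ cong (λ k → φ (map₁ suc s) + (k * φ s + φ (map₂ suc s))) (trans (length-map toℕ is) (suc-injective |p|)) ⟩
  φ (map₁ suc s) + (m * φ s + φ (map₂ suc s))
    ≡⟨ +-assoc (φ (map₁ suc s)) (m * φ s) (φ (map₂ suc s)) ⟨
  φ (map₁ suc s) + m * φ s + φ (map₂ suc s) ∎
  where
  open ≡-Reasoning
  ws = insertions Fin.zero (map Fin.suc p)
  s = permMaxima p

sum-map-insertionPerms-suc : ∀ m (φ : ℕ × ℕ → ℕ) →
  sum (map (φ ∘ permMaxima) (insertionPerms (suc (suc m)))) ≡
  sum (map (φ ∘ map₁ suc ∘ permMaxima) (insertionPerms (suc m))) +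
  m * sum (map (φ ∘ permMaxima) (insertionPerms (suc m))) +
  sum (map (φ ∘ map₂ suc ∘ permMaxima) (insertionPerms (suc m)))
sum-map-insertionPerms-suc m φ = begin
  sum (map (φ ∘ permMaxima) (insertionPerms (suc (suc m))))
    ≡⟨ sum-map-concatMap (φ ∘ permMaxima) (insertions Fin.zero ∘ map Fin.suc) P ⟩
  sum (map (λ p → sum (map (φ ∘ permMaxima) (insertions Fin.zero (map Fin.suc p)))) P)
    ≡⟨ cong sum (map-cong-local (All.tabulate λ {p} p∈ → sum-map-insertions φ p (proj₁ (∈-insertionPerms⁻ (suc m) p∈)))) ⟩
  sum (map (λ p → u p + m * v p + w p) P)
    ≡⟨ sum-map-+ (λ p → u p + m * v p) w P ⟩
  sum (map (λ p → u p + m * v p) P) + sum (map w P)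
    ≡⟨ cong (_+ sum (map w P)) (trans (sum-map-+ u (λ p → m * v p) P) (cong (sum (map u P) +_) (sum-map-* m v P))) ⟩
  sum (map u P) + m * sum (map v P) + sum (map w P) ∎
  where
  open ≡-Reasoning
  P = insertionPerms (suc m)
  u v w : List (Fin (suc m)) → ℕ
  u = φ ∘ map₁ suc ∘ permMaxima
  v = φ ∘ permMaxima
  w = φ ∘ map₂ suc ∘ permMaxima

-- Decided exactly as in the filter defining f, so that f is literally a sum of hits.
hit : ℕ → ℕ → ℕ × ℕ → ℕ
hit a b (L , R) = if does ((L ≟ a) ×-dec (R ≟ b)) then 1 else 0

f≡sum-hit : ∀ n a b → f n a b ≡ sum (map (hit a b ∘ permMaxima) (insertionPerms n))
f≡sum-hit n a b = begin
  length (filter Q? (perms n))                     ≡⟨ length-filter≡sum Q? (perms n) ⟩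
  sum (map (hit a b ∘ permMaxima) (perms n))       ≡⟨ sum-↭ (map⁺ (hit a b ∘ permMaxima) (perms↭insertionPerms n)) ⟩
  sum (map (hit a b ∘ permMaxima) (insertionPerms n)) ∎
  where
  open ≡-Reasoning
  Q? = λ (π : List (Fin n)) → (ltrMax (map toℕ π) ≟ a) ×-dec (rtlMax (map toℕ π) ≟ b)

shiftˡ shiftʳ : (ℕ → ℕ → ℕ) → ℕ → ℕ → ℕ
shiftˡ g zero    b = 0
shiftˡ g (suc a) b = g a b
shiftʳ g a zero    = 0
shiftʳ g a (suc b) = g a b

shiftˡ-cong : ∀ {g h} → (∀ a b → g a b ≡ h a b) → ∀ a b → shiftˡ g a b ≡ shiftˡ h a b
shiftˡ-cong g≡h zero    b = refl
shiftˡ-cong g≡h (suc a) b = g≡h a b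

shiftʳ-cong : ∀ {g h} → (∀ a b → g a b ≡ h a b) → ∀ a b → shiftʳ g a b ≡ shiftʳ h a b
shiftʳ-cong g≡h a zero    = refl
shiftʳ-cong g≡h a (suc b) = g≡h a b

sum-hit-map₁-suc : ∀ n a b → sum (map (hit a b ∘ map₁ suc ∘ permMaxima) (insertionPerms n)) ≡ shiftˡ (f n) a b
sum-hit-map₁-suc n zero    b = sum-map-const-0 (insertionPerms n)
sum-hit-map₁-suc n (suc a) b = sym (f≡sum-hit n a b)

sum-hit-map₂-suc : ∀ n a b → sum (map (hit a b ∘ map₂ suc ∘ permMaxima) (insertionPerms n)) ≡ shiftʳ (f n) a b
sum-hit-map₂-suc n a zero    = trans (cong sum (map-cong never-hit (insertionPerms n))) (sum-map-const-0 (insertionPerms n))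
  where
  never-hit : ∀ π → hit a 0 (map₂ suc (permMaxima π)) ≡ 0
  never-hit π = cong (if_then 1 else 0) (∧-zeroʳ (does (ltrMax (map toℕ π) ≟ a)))
sum-hit-map₂-suc n a (suc b) = sym (f≡sum-hit n a b)

f-suc : ∀ m a b → f (suc (suc m)) a b ≡ shiftˡ (f (suc m)) a b + m * f (suc m) a b + shiftʳ (f (suc m)) a b
f-suc m a b = begin
  f (suc (suc m)) a b
    ≡⟨ f≡sum-hit (suc (suc m)) a b ⟩
  sum (map (hit a b ∘ permMaxima) (insertionPerms (suc (suc m))))
    ≡⟨ sum-map-insertionPerms-suc m (hit a b) ⟩
  sum (map (hit a b ∘ map₁ suc ∘ permMaxima) (insertionPerms (suc m))) +
  m * sum (map (hit a b ∘ permMaxima) (insertionPerms (suc m))) +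
  sum (map (hit a b ∘ map₂ suc ∘ permMaxima) (insertionPerms (suc m)))
    ≡⟨ cong₂ _+_ (cong₂ (λ x y → x + m * y) (sum-hit-map₁-suc (suc m) a b) (sym (f≡sum-hit (suc m) a b)))
                 (sum-hit-map₂-suc (suc m) a b) ⟩
  shiftˡ (f (suc m)) a b + m * f (suc m) a b + shiftʳ (f (suc m)) a b ∎
  where open ≡-Reasoning

-- The closed form

-- binom i j = (i + j choose i), by the symmetric Pascal recurrence.
binom : ℕ → ℕ → ℕ
binom zero    j       = 1
binom (suc i) zero    = 1
binom (suc i) (suc j) = binom i (suc j) + binom (suc i) j

stirling₁ : ℕ → ℕ → ℕ
stirling₁ zero    zero    = 1
stirling₁ zero    (suc k) = 0
stirling₁ (suc m) zero    = 0
stirling₁ (suc m) (suc k) = stirling₁ m k + m * stirling₁ m (suc k)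

closedForm : ℕ → ℕ → ℕ → ℕ
closedForm m zero    b       = 0
closedForm m (suc i) zero    = 0
closedForm m (suc i) (suc j) = binom i j * stirling₁ m (i + j)

binom-zeroʳ : ∀ i → binom i 0 ≡ 1
binom-zeroʳ zero    = refl
binom-zeroʳ (suc i) = refl

closedForm-zeroʳ : ∀ m a → closedForm m a 0 ≡ 0
closedForm-zeroʳ m zero    = refl
closedForm-zeroʳ m (suc a) = refl

closedForm-suc-suc : ∀ m i j →
  binom i j * stirling₁ (suc m) (i + j) ≡ closedForm m i (suc j) + m * (binom i j * stirling₁ m (i + j)) + closedForm m (suc i) j
closedForm-suc-suc zero    zero    zero    = refl
closedForm-suc-suc (suc m) zero    zero    = sym (trans (+-identityʳ _) (*-zeroʳ (suc m)))
closedForm-suc-suc m       (suc i) zero    rewrite binom-zeroʳ i | +-identityʳ i =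
  semiring-identity (stirling₁ m i) (stirling₁ m (suc i)) m
  where
  semiring-identity : ∀ x y m → x + m * y + 0 ≡ x + 0 + m * (y + 0) + 0
  semiring-identity = solve-∀
closedForm-suc-suc m       zero    (suc j) = semiring-identity (stirling₁ m j) (stirling₁ m (suc j)) m
  where
  semiring-identity : ∀ x y m → x + m * y + 0 ≡ m * (y + 0) + (x + 0)
  semiring-identity = solve-∀
closedForm-suc-suc m       (suc i) (suc j) rewrite +-suc i j =
  semiring-identity (binom i (suc j)) (binom (suc i) j) (stirling₁ m (suc (i + j))) (stirling₁ m (suc (suc (i + j)))) m
  where
  semiring-identity : ∀ X Y s t m → (X + Y) * (s + m * t) ≡ X * s + m * ((X + Y) * t) + Y * s
  semiring-identity = solve-∀

closedForm-suc : ∀ m a b → closedForm (suc m) a b ≡ shiftˡ (closedForm m) a b + m * closedForm m a b + shiftʳ (closedForm m) a b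
closedForm-suc m zero    zero    = sym (trans (+-identityʳ _) (*-zeroʳ m))
closedForm-suc m zero    (suc b) = sym (trans (+-identityʳ _) (*-zeroʳ m))
closedForm-suc m (suc i) zero    = sym (trans (+-identityʳ _) (trans (cong (_+ m * 0) (closedForm-zeroʳ m i)) (*-zeroʳ m)))
closedForm-suc m (suc i) (suc j) = closedForm-suc-suc m i j

f-1 : ∀ a b → f 1 a b ≡ closedForm 0 a b
f-1 zero          b             = refl
f-1 (suc zero)    zero          = refl
f-1 (suc zero)    (suc zero)    = refl
f-1 (suc zero)    (suc (suc j)) = refl
f-1 (suc (suc i)) zero          = refl
f-1 (suc (suc i)) (suc j)       = sym (*-zeroʳ (binom (suc i) j))

f-closedForm : ∀ m a b → f (suc m) a b ≡ closedForm m a b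
f-closedForm zero    a b = f-1 a b
f-closedForm (suc m) a b = begin
  f (suc (suc m)) a b
    ≡⟨ f-suc m a b ⟩
  shiftˡ (f (suc m)) a b + m * f (suc m) a b + shiftʳ (f (suc m)) a b
    ≡⟨ cong₂ _+_ (cong₂ (λ x y → x + m * y) (shiftˡ-cong (f-closedForm m) a b) (f-closedForm m a b))
                 (shiftʳ-cong (f-closedForm m) a b) ⟩
  shiftˡ (closedForm m) a b + m * closedForm m a b + shiftʳ (closedForm m) a b
    ≡⟨ closedForm-suc m a b ⟨
  closedForm (suc m) a b ∎
  where open ≡-Reasoning

-- Growth towards the diagonal

binom-one : ∀ j → binom 1 j ≡ suc j
binom-one zero    = refl
binom-one (suc j) = cong suc (binom-one j)

binom-sym : ∀ i j → binom i j ≡ binom j i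
binom-sym zero    zero    = refl
binom-sym zero    (suc j) = refl
binom-sym (suc i) zero    = refl
binom-sym (suc i) (suc j) = trans (cong₂ _+_ (binom-sym i (suc j)) (binom-sym (suc i) j)) (+-comm (binom (suc j) i) (binom j (suc i)))

binom-pos : ∀ i j → 0 < binom i j
binom-pos zero    j       = s≤s z≤n
binom-pos (suc i) zero    = s≤s z≤n
binom-pos (suc i) (suc j) = ≤-trans (binom-pos i (suc j)) (m≤m+n _ _)

binom-absorptionˡ : ∀ i j → suc i * binom (suc i) j ≡ suc (i + j) * binom i j
binom-absorptionˡ zero    j       = trans (+-identityʳ (binom 1 j)) (trans (binom-one j) (sym (*-identityʳ (suc j))))
binom-absorptionˡ (suc i) zero    rewrite +-identityʳ i = refl
binom-absorptionˡ (suc i) (suc j) = begin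
  suc (suc i) * (U + V + W)
    ≡⟨ *-distribˡ-+ (suc (suc i)) (U + V) W ⟩
  suc (suc i) * (U + V) + suc (suc i) * W
    ≡⟨ cong₂ _+_ (cong (U + V +_) (binom-absorptionˡ i (suc j))) (binom-absorptionˡ (suc i) j) ⟩
  U + V + suc (i + suc j) * U + suc (suc i + j) * V
    ≡⟨ cong (λ k → U + V + suc k * U + suc (suc i + j) * V) (+-suc i j) ⟩
  U + V + K * U + K * V
    ≡⟨ semiring-identity U V K ⟩
  suc K * (U + V)
    ≡⟨ cong (λ k → suc (suc k) * (U + V)) (+-suc i j) ⟨
  suc (suc i + suc j) * (U + V) ∎
  where
  open ≡-Reasoning
  U = binom i (suc j)
  V = binom (suc i) j
  W = binom (suc (suc i)) j
  K = suc (suc (i + j))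
  semiring-identity : ∀ U V K → U + V + K * U + K * V ≡ suc K * (U + V)
  semiring-identity = solve-∀

binom-absorptionʳ : ∀ i j → suc j * binom i (suc j) ≡ suc (i + j) * binom i j
binom-absorptionʳ i j = begin
  suc j * binom i (suc j)  ≡⟨ cong (suc j *_) (binom-sym i (suc j)) ⟩
  suc j * binom (suc j) i  ≡⟨ binom-absorptionˡ j i ⟩
  suc (j + i) * binom j i  ≡⟨ cong₂ (λ k x → suc k * x) (+-comm j i) (binom-sym j i) ⟩
  suc (i + j) * binom i j  ∎
  where open ≡-Reasoning

p*x≡q*y⇒x<y : ∀ {p q x y} → p * x ≡ q * y → q < p → 0 < y → x < y
p*x≡q*y⇒x<y {p} {q} {x} {y} eq q<p 0<y = ≰⇒> λ y≤x → <-irrefl refl (begin-strict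
  q * y  <⟨ *-monoˡ-< y {{>-nonZero 0<y}} q<p ⟩
  p * y  ≤⟨ *-monoʳ-≤ p y≤x ⟩
  p * x  ≡⟨ eq ⟩
  q * y  ∎)
  where open ≤-Reasoning

binom-<-toward-middle : ∀ {j k} → j < k → binom (suc k) j < binom k (suc j)
binom-<-toward-middle {j} {k} j<k =
  p*x≡q*y⇒x<y (trans (binom-absorptionˡ k j) (sym (binom-absorptionʳ k j))) (s≤s j<k) (binom-pos k (suc j))

stirling₁-above : ∀ m k → stirling₁ m (suc (m + k)) ≡ 0
stirling₁-above zero    k = refl
stirling₁-above (suc m) k rewrite stirling₁-above m k | sym (+-suc m k) | stirling₁-above m (suc k) = *-zeroʳ m

stirling₁-diag : ∀ m → stirling₁ m m ≡ 1
stirling₁-diag zero    = refl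
stirling₁-diag (suc m) = begin
  stirling₁ m m + m * stirling₁ m (suc m)  ≡⟨ cong₂ (λ x y → x + m * y) (stirling₁-diag m) (subst (λ k → stirling₁ m (suc k) ≡ 0) (+-identityʳ m) (stirling₁-above m 0)) ⟩
  1 + m * 0                                ≡⟨ cong suc (*-zeroʳ m) ⟩
  1                                        ∎
  where open ≡-Reasoning

closedForm-sym : ∀ m a b → closedForm m a b ≡ closedForm m b a
closedForm-sym m zero    zero    = refl
closedForm-sym m zero    (suc b) = refl
closedForm-sym m (suc a) zero    = refl
closedForm-sym m (suc i) (suc j) = cong₂ _*_ (binom-sym i j) (cong (stirling₁ m) (+-comm i j))

closedForm-[1+m,1] : ∀ m → closedForm m (suc m) 1 ≡ 1
closedForm-[1+m,1] m = trans (cong₂ _*_ (binom-zeroʳ m) (cong (stirling₁ m) (+-identityʳ m))) (cong (1 *_) (stirling₁-diag m))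

closedForm-<-toward-diagonal : ∀ m {a b} → b < a → 0 < closedForm m (suc a) b → closedForm m (suc a) b < closedForm m a (suc b)
closedForm-<-toward-diagonal m {suc k} {suc j} (s≤s j<k) pos =
  subst (λ t → binom (suc k) j * S < binom k (suc j) * stirling₁ m t) (sym (+-suc k j))
    (*-monoˡ-< S {{m*n≢0⇒n≢0 (binom (suc k) j) {{>-nonZero pos}}}} (binom-<-toward-middle j<k))
  where S = stirling₁ m (suc (k + j))

Maximizer : (ℕ → ℕ → ℕ) → ℕ → ℕ → Set
Maximizer g a b = ∀ a′ b′ → NonZero a′ → NonZero b′ → g a b ≥ g a′ b′

closedForm-Maximizer-sym : ∀ m a b → Maximizer (closedForm m) a b → Maximizer (closedForm m) b a
closedForm-Maximizer-sym m a b max a′ b′ a′≢0 b′≢0 =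
  subst₂ _≤_ (closedForm-sym m b′ a′) (closedForm-sym m a b) (max b′ a′ b′≢0 a′≢0)

closedForm-Maximizer⇒∸≤1 : ∀ m a b → Maximizer (closedForm m) a b → a ∸ b ≤ 1
closedForm-Maximizer⇒∸≤1 m zero    b max = m≤n+o⇒m∸n≤o 0 b z≤n
closedForm-Maximizer⇒∸≤1 m (suc a) b max = m≤n+o⇒m∸n≤o (suc a) b (≮⇒≥ λ b+1<1+a →
  let b<a = s<s⁻¹ (subst (_< suc a) (+-comm b 1) b+1<1+a) in
  <⇒≱ (closedForm-<-toward-diagonal m b<a pos) (max a (suc b) (>-nonZero (≤-<-trans z≤n b<a)) _))
  where
  -- compare with (m + 1, 1), attained only by the identity permutation
  pos : 0 < closedForm m (suc a) b
  pos = subst (_≤ closedForm m (suc a) b) (closedForm-[1+m,1] m) (max (suc m) 1 _ _)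

theorem1 : (n : ℕ) → NonZero n →
    (a b : ℕ) → NonZero a → NonZero b →
    ((a′ b′ : ℕ) → NonZero a′ → NonZero b′ → f n a b ≥ f n a′ b′) →
    (a ∸ b ≤ 1) × (b ∸ a ≤ 1)
theorem1 (suc m) _ a b _ _ max =
  closedForm-Maximizer⇒∸≤1 m a b max′ , closedForm-Maximizer⇒∸≤1 m b a (closedForm-Maximizer-sym m a b max′)
  where
  max′ : Maximizer (closedForm m) a b
  max′ a′ b′ a′≢0 b′≢0 = subst₂ _≤_ (f-closedForm m a′ b′) (f-closedForm m a b) (max a′ b′ a′≢0 b′≢0)
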